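{- Let $G$ be a factorizable graph, $M$ a perfect matching of $G$, $H\in\mathcal{G}(G)$ and $S\in\mathcal{P}_G(H)$. Then for any $x\in U^*(S)$ there is an $M$-balanced path from $x$ to some vertex $y\in S$ all of whose vertices other than $y$ lie in $U(S)$.
   Context: All graphs are finite. A graph is factorizable if it has a perfect matching, factor-critical if deleting any single vertex yields the empty graph or a factorizable graph. $G[X]$ induced subgraph, $G/X$ contraction of $X$ into one vertex, $\Gamma(X)$ the vertices outside $X$ adjacent to $X$. For factorizable $G$: an edge is allowed if it lies in some perfect matching; for each connected component $C$ of the subgraph formed by allowed edges, $G[V(C)]$ is a factor-component; $\mathcal{G}(G)$ is their set; $X$ is separating if every $H\in\mathcal{G}(G)$ has $V(H)\subseteq X$ or $V(H)\cap X=\emptyset$. For a matching $M$, an $M$-balanced path from $u$ to $v$ is a path $P$ with ends $u,v$, with $E(P)\setminus M$ a matching, an even number of edges, and $M\cap E(P)$ covering all vertices of $P$ except $v$ (a single-vertex path counts). Cathedral structure: $G_1\trianglelefteq G_2$ if there is a separating $X\supseteq V(G_1)\cup V(G_2)$ with $G[X]/V(G_1)$ factor-critical (a partial order on $\mathcal{G}(G)$). $u\sim_G v$ if $u,v$ lie in the same factor-component and $G-u-v$ is not factorizable (an equivalence relation); $\mathcal{P}(G)$ is its set of classes, $\mathcal{P}_G(H)=\{S\in\mathcal{P}(G):S\subseteq V(H)\}$. $U^*(H)=\bigcup\{V(H'):H\trianglelefteq H'\}$, $U(H)=U^*(H)\setminus V(H)$. For $S\in\mathcal{P}_G(H)$,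 $U(S)$ is the union of $V(H')$ over all $H'\in\mathcal{G}(G)$ with $H\trianglelefteq H'$, $H'\neq H$, for which some connected component $K$ of $G[U(H)]$ has $\Gamma(K)\cap V(H)\subseteq S$ and $V(H')\subseteq V(K)$; $U^*(S)=U(S)\cup S$. -}

module Defs where

open import Data.Nat using (ℕ; zero; suc; _+_)
open import Data.Fin using (Fin; inject₁; fromℕ) renaming (suc to fsuc)
open import Data.Bool using (Bool; T)
open import Data.Maybe using (Maybe; just; nothing)
open import Data.Product using (Σ; _×_; _,_; proj₁)
open import Data.Sum using (_⊎_)
open import Data.Unit using (⊤)
open import Data.Empty using (⊥)
open import Function.Definitions using (Injective)
open import Relation.Nullary using (¬_)
open import Relation.Binary.PropositionalEquality using (_≡_; _≢_)
open import Relation.Binary.Construct.Closure.ReflexiveTransitive using (Star)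

record Graph : Set₁ where
  field
    V : Set
    E : V → V → Set

open Graph public

-- A perfect matching of the induced subgraph G[Y], represented as a
-- fixed-point-free involution μ on Y along edges: the edges of the
-- matching are {v , μ v} for v ∈ Y.
PerfectMatchingOn : (G : Graph) → (V G → Set) → Set
PerfectMatchingOn G Y =
  Σ (V G → V G) λ μ → ∀ v → Y v →
    Y (μ v) × (μ (μ v) ≡ v) × (μ v ≢ v) × E G v (μ v)

FactorizableOn : (G : Graph) → (V G → Set) → Set
FactorizableOn G Y = PerfectMatchingOn G Y

FactorCriticalOn : (G : Graph) → (V G → Set) → Set
FactorCriticalOn G Y = ∀ v → Y v → FactorizableOn G (λ w → Y w × w ≢ v)

record SGraph (n : ℕ) : Set₁ where
  field
    adj    : Fin n → Fin n → Set
    sym    : ∀ {u v} → adj u v → adj v u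
    irrefl : ∀ {v} → ¬ adj v v

open SGraph public

module _ {n : ℕ} (G : SGraph n) where

  toGraph : Graph
  toGraph = record { V = Fin n ; E = adj G }

  PerfectMatching : Set
  PerfectMatching = PerfectMatchingOn toGraph (λ _ → ⊤)

  Factorizable : Set
  Factorizable = FactorizableOn toGraph (λ _ → ⊤)

  FactorizableMinus2 : Fin n → Fin n → Set
  FactorizableMinus2 u v = FactorizableOn toGraph (λ w → (w ≢ u) × (w ≢ v))

  Allowed : Fin n → Fin n → Set
  Allowed u v = adj G u v × Σ PerfectMatching (λ M → proj₁ M u ≡ v)

  -- u and v lie in the same factor-component (connected component of
  -- the subgraph formed by the allowed edges)
  SameFC : Fin n → Fin n → Set
  SameFC = Star Allowed

  -- A factor-component H is represented by any of its vertices h;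
  -- V(H) = FC h.
  FC : Fin n → Fin n → Set
  FC h v = SameFC h v

  Separating : (Fin n → Bool) → Set
  Separating X = ∀ h → (∀ v → FC h v → T (X v)) ⊎ (∀ v → FC h v → ¬ T (X v))

  -- G[X] / Y  (contraction of Y ⊆ X into the vertex 'nothing')
  ContractGraph : (Fin n → Set) → Graph
  ContractGraph Y = record { V = Maybe (Fin n) ; E = CE }
    where
    CE : Maybe (Fin n) → Maybe (Fin n) → Set
    CE (just a) (just b) = adj G a b
    CE (just a) nothing  = Σ (Fin n) λ y → Y y × adj G a y
    CE nothing  (just b) = Σ (Fin n) λ y → Y y × adj G y b
    CE nothing  nothing  = ⊥

  ContractVerts : (Fin n → Bool) → (Fin n → Set) → Maybe (Fin n) → Set
  ContractVerts X Y (just v) = T (X v) × ¬ Y v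
  ContractVerts X Y nothing  = ⊤

  _⊴_ : Fin n → Fin n → Set
  h1 ⊴ h2 = Σ (Fin n → Bool) λ X →
    Separating X × (∀ v → FC h1 v → T (X v)) × (∀ v → FC h2 v → T (X v)) ×
    FactorCriticalOn (ContractGraph (FC h1)) (ContractVerts X (FC h1))

  _∼_ : Fin n → Fin n → Set
  u ∼ v = SameFC u v × ¬ FactorizableMinus2 u v

  UStarH : Fin n → Fin n → Set
  UStarH h x = Σ (Fin n) λ h' → (h ⊴ h') × FC h' x

  UH : Fin n → Fin n → Set
  UH h x = UStarH h x × ¬ FC h x

  -- connected component K of G[U(H)] represented by a vertex k ∈ U(H):
  -- V(K) = CompU h k
  CompU : Fin n → Fin n → Fin n → Set
  CompU h k w = Star (λ a b → UH h a × UH h b × adj G a b) k w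

  Nbr : (Fin n → Set) → Fin n → Set
  Nbr K v = ¬ K v × Σ (Fin n) λ w → K w × adj G w v

  -- U(S) for S = the ∼-class of s, S ∈ P_G(H)
  US : Fin n → Fin n → Fin n → Set
  US h s x = Σ (Fin n) λ h' → Σ (Fin n) λ k →
    (h ⊴ h') × ¬ SameFC h h' × UH h k ×
    (∀ v → Nbr (CompU h k) v → FC h v → s ∼ v) ×
    (∀ w → FC h' w → CompU h k w) ×
    FC h' x

  UStarS : Fin n → Fin n → Fin n → Set
  UStarS h s x = US h s x ⊎ (s ∼ x)

  -- M-balanced path from x to y with 2k edges, given by its vertex
  -- sequence p 0, ..., p (2k)  (M given by the involution μ).
  record BalancedPath (μ : Fin n → Fin n) (x y : Fin n) (k : ℕ)
                      (p : Fin (suc (k + k)) → Fin n) : Set where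
    Incident : Fin (k + k) → Fin n → Set
    Incident i v = (v ≡ p (inject₁ i)) ⊎ (v ≡ p (fsuc i))
    InM : Fin (k + k) → Set
    InM i = μ (p (inject₁ i)) ≡ p (fsuc i)
    field
      distinct : Injective _≡_ _≡_ p
      edges    : ∀ i → adj G (p (inject₁ i)) (p (fsuc i))
      start    : p Data.Fin.zero ≡ x
      end      : p (fromℕ (k + k)) ≡ y
      -- E(P) \ M is a matching
      nonM-matching : ∀ i j v → i ≢ j → ¬ InM i → ¬ InM j →
                      Incident i v → Incident j v → ⊥
      -- M ∩ E(P) covers all vertices of P except y
      covers   : ∀ a → p a ≢ y → Σ (Fin (k + k)) λ i → InM i × Incident i (p a)
      uncovered : ∀ i → InM i → ¬ Incident i y

-- Let x lie in V(H′) ⊆ U(S), with X the separating set witnessing H ⊴ H′.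
-- Since G[X]/V(H) is factor-critical, the contraction minus x has a perfect
-- matching M′.  Starting at x, alternately follow an edge of M and an edge of
-- M′; as long as the M′-partner is a vertex of G the walk stays in X ∖ V(H),
-- hence in the component K of G[U(H)] containing V(H′).  Both matchings are
-- involutions and M′ avoids x, so the walk never repeats a vertex and must
-- reach a vertex matched by M′ to the contracted vertex, i.e. one adjacent to
-- some y ∈ V(H).  Then y ∈ Γ(K) ∩ V(H) ⊆ S, and the walk followed by y is the
-- required M-balanced path: every vertex of the walk lies, together with its
-- factor-component, inside K, hence in U(S).

module Submission where

open import Defs hiding (sym)
open import Data.Nat using (ℕ; zero; suc; _+_; _≤_; _<_; z≤n; s≤s; s≤s⁻¹)
open import Data.Nat.Properties
  using ( +-suc; +-identityʳ; +-comm; suc-injective; ≤-trans; ≤-refl; n≤1+n; m≤m+n; <⇒≤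
        ; m<1+n⇒m<n∨m≡n; m≤n⇒m<n∨m≡n; m≤n⇒∃[o]m+o≡n; <-cmp; <-irrefl; ≤∧≢⇒<; <⇒≱; ≰⇒>
        ; 0≢1+n; _≤?_ )
open import Data.Fin using (Fin; toℕ; fromℕ<; inject₁)
open import Data.Fin.Properties using (toℕ-injective; toℕ-fromℕ; toℕ-inject₁; toℕ-fromℕ<; toℕ<n; pigeonhole)
open import Data.Bool using (Bool; T)
open import Data.Maybe using (Maybe; just; nothing; fromMaybe)
open import Data.Maybe.Properties using (just-injective)
open import Data.Product using (Σ; ∃; _×_; _,_; proj₁; proj₂)
open import Data.Sum using (_⊎_; inj₁; inj₂)
open import Data.Unit using (tt)
open import Data.Empty using (⊥; ⊥-elim)
open import Function using (_∘_)
open import Relation.Nullary using (¬_; yes; no; contradiction)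
open import Relation.Binary using (tri<; tri≈; tri>)
open import Relation.Binary.PropositionalEquality
open ≡-Reasoning
open import Relation.Binary.Construct.Closure.ReflexiveTransitive as Star
  using (Star; ε; _◅_; _◅◅_; reverse)

double : ℕ → ℕ
double zero    = zero
double (suc d) = suc (suc (double d))

double≡+ : ∀ d → double d ≡ d + d
double≡+ zero    = refl
double≡+ (suc d) = cong suc (trans (cong suc (double≡+ d)) (sym (+-suc d d)))

double-injective : ∀ {d e} → double d ≡ double e → d ≡ e
double-injective {zero}  {zero}  _  = refl
double-injective {suc d} {suc e} eq = cong suc (double-injective (suc-injective (suc-injective eq)))

double≢suc-double : ∀ d e → double d ≢ suc (double e)
double≢suc-double (suc d) (suc e) eq = double≢suc-double d e (suc-injective (suc-injective eq))

even-or-odd : ∀ t → (∃ λ d → t ≡ double d) ⊎ (∃ λ d → t ≡ suc (double d))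
even-or-odd zero = inj₁ (0 , refl)
even-or-odd (suc t) with even-or-odd t
... | inj₁ (d , refl) = inj₂ (d , refl)
... | inj₂ (d , refl) = inj₁ (suc d , refl)

odd-edges-disjoint : ∀ {d e q} → q ≡ suc (double d) ⊎ q ≡ double (suc d) →
                     q ≡ suc (double e) ⊎ q ≡ double (suc e) → d ≡ e
odd-edges-disjoint         (inj₁ refl) (inj₁ eq) = double-injective (suc-injective eq)
odd-edges-disjoint {d} {e} (inj₁ refl) (inj₂ eq) = ⊥-elim (double≢suc-double (suc e) d (sym eq))
odd-edges-disjoint {d} {e} (inj₂ refl) (inj₁ eq) = ⊥-elim (double≢suc-double (suc d) e eq)
odd-edges-disjoint         (inj₂ refl) (inj₂ eq) = suc-injective (double-injective eq)

toℕ≤double : ∀ {k} (a : Fin (suc (k + k))) → toℕ a ≤ double k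
toℕ≤double {k} a = subst (toℕ a ≤_) (sym (double≡+ k)) (s≤s⁻¹ (toℕ<n a))

module _ {P : ℕ → Set} {N : ℕ} where

  extend-< : (∀ i → i < N → P i) → P N → ∀ i → i < suc N → P i
  extend-< below top i i<1+N with m<1+n⇒m<n∨m≡n i<1+N
  ... | inj₁ i<N  = below i i<N
  ... | inj₂ refl = top

  extend-≤ : (∀ i → i ≤ N → P i) → P (suc N) → ∀ i → i ≤ suc N → P i
  extend-≤ below top i i≤1+N with m≤n⇒m<n∨m≡n i≤1+N
  ... | inj₁ i<1+N = below i (s≤s⁻¹ i<1+N)
  ... | inj₂ refl  = top

-- Walks alternating between two maps

module AlternatingWalk {A : Set} (μ β : A → A) (x : A) where

  step : ℕ → A → A
  step zero          = μ
  step (suc zero)    = β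
  step (suc (suc i)) = step i

  walk : ℕ → A
  walk zero    = x
  walk (suc i) = step i (walk i)

  step-+-double : ∀ m d → step (m + double d) ≡ step m
  step-+-double m zero    = cong step (+-identityʳ m)
  step-+-double m (suc d) = begin
    step (m + suc (suc (double d)))  ≡⟨ cong step (trans (+-suc m _) (cong suc (+-suc m _))) ⟩
    step (suc (suc (m + double d)))  ≡⟨ step-+-double m d ⟩
    step m                           ∎

  walk-odd : ∀ d → walk (suc (double d)) ≡ μ (walk (double d))
  walk-odd d = cong (λ f → f (walk (double d))) (step-+-double 0 d)

  walk-even : ∀ d → walk (double (suc d)) ≡ β (walk (suc (double d)))
  walk-even d = cong (λ f → f (walk (suc (double d)))) (step-+-double 1 d)

  record Reversible (N : ℕ) : Set where
    field
      backward     : ∀ i → i < N → step i (walk (suc i)) ≡ walk i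
      moves        : ∀ i → i < N → walk (suc i) ≢ walk i
      avoids-start : ∀ d → double (suc d) ≤ N → walk (double (suc d)) ≢ x

  open Reversible

  reversible-zero : Reversible 0
  reversible-zero = record { backward = λ _ () ; moves = λ _ () ; avoids-start = λ _ () }

  reversible-suc : ∀ {N} → Reversible N →
                   step N (walk (suc N)) ≡ walk N → walk (suc N) ≢ walk N →
                   (∀ d → double (suc d) ≡ suc N → walk (suc N) ≢ x) → Reversible (suc N)
  reversible-suc {N} r back move avoid = record
    { backward     = extend-< (backward r) back
    ; moves        = extend-< (moves r) move
    ; avoids-start = avoids-start′
    }
    where
    avoids-start′ : ∀ d → double (suc d) ≤ suc N → walk (double (suc d)) ≢ x
    avoids-start′ d le with m≤n⇒m<n∨m≡n le
    ... | inj₁ lt = avoids-start r d (s≤s⁻¹ lt)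
    ... | inj₂ eq = subst (λ t → walk t ≢ x) (sym eq) (avoid d eq)

  module _ {N : ℕ} (r : Reversible N) where

    -- Walking back m steps along the involutions turns an even return into a return to x.
    no-even-return : ∀ m d → m + double (suc d) ≤ N → walk m ≢ walk (m + double (suc d))
    no-even-return zero    d le eq = avoids-start r d le (sym eq)
    no-even-return (suc m) d le eq = no-even-return m d (≤-trans (n≤1+n _) le) (begin
      walk m                             ≡⟨ backward r m m<N ⟨
      step m (walk (suc m))              ≡⟨ cong (step m) eq ⟩
      step m (walk (suc (m + D)))        ≡⟨ cong (λ f → f (walk (suc (m + D)))) (step-+-double m (suc d)) ⟨
      step (m + D) (walk (suc (m + D)))  ≡⟨ backward r (m + D) le ⟩
      walk (m + D)                       ∎)
      where
      D = double (suc d)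
      m<N : m < N
      m<N = ≤-trans (s≤s (m≤m+n m D)) le

    -- Stepping forward from both ends shrinks an odd gap by two, down to a single step.
    no-odd-return : ∀ m d → m + suc (double d) ≤ N → walk m ≢ walk (m + suc (double d))
    no-odd-return m zero le eq =
      moves r m (subst (_≤ N) (+-comm m 1) le) (sym (trans eq (cong walk (+-comm m 1))))
    no-odd-return m (suc d) le eq = no-odd-return (suc m) d (subst (_≤ N) q≡ (<⇒≤ q<N)) (begin
      walk (suc m)                       ≡⟨ cong (step m) eq ⟩
      step m (walk (m + suc q′))         ≡⟨ cong (step m ∘ walk) (+-suc m q′) ⟩
      step m (walk (suc q))              ≡⟨ cong (λ f → f (walk (suc q))) (step-+-double m (suc d)) ⟨
      step q (walk (suc q))              ≡⟨ backward r q q<N ⟩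
      walk q                             ≡⟨ cong walk q≡ ⟩
      walk (suc (m + suc (double d)))    ∎)
      where
      q′ = double (suc d)
      q  = m + q′
      q<N : q < N
      q<N = subst (_≤ N) (+-suc m q′) le
      q≡ : q ≡ suc (m + suc (double d))
      q≡ = +-suc m (suc (double d))

    no-return : ∀ {m l} → m < l → l ≤ N → walk m ≢ walk l
    no-return {m} m<l l≤N with m≤n⇒∃[o]m+o≡n m<l
    ... | o , refl with even-or-odd o
    ...   | inj₁ (d , refl) = λ eq →
      no-odd-return m d (subst (_≤ N) (sym (+-suc m _)) l≤N) (trans eq (cong walk (sym (+-suc m _))))
    ...   | inj₂ (d , refl) = λ eq →
      no-even-return m d (subst (_≤ N) (sym (+-suc m _)) l≤N) (trans eq (cong walk (sym (+-suc m _))))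

    walk-injective : ∀ {m l} → m ≤ N → l ≤ N → walk m ≡ walk l → m ≡ l
    walk-injective {m} {l} m≤N l≤N eq with <-cmp m l
    ... | tri< m<l _ _ = ⊥-elim (no-return m<l l≤N eq)
    ... | tri≈ _ m≡l _ = m≡l
    ... | tri> _ _ l<m = ⊥-elim (no-return l<m m≤N (sym eq))

module Extend {A : Set} (c : ℕ → A) (N : ℕ) (y : A) where

  c⁺ : ℕ → A
  c⁺ t with t ≤? N
  ... | yes _ = c t
  ... | no  _ = y

  c⁺-≤ : ∀ {t} → t ≤ N → c⁺ t ≡ c t
  c⁺-≤ {t} t≤N with t ≤? N
  ... | yes _   = refl
  ... | no  t≰N = contradiction t≤N t≰N

  c⁺-last : c⁺ (suc N) ≡ y
  c⁺-last with suc N ≤? N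
  ... | yes N<N = contradiction N<N (<-irrefl refl)
  ... | no  _   = refl

  c⁺-view : ∀ {t} → t ≤ suc N → (t ≤ N × c⁺ t ≡ c t) ⊎ (t ≡ suc N × c⁺ t ≡ y)
  c⁺-view t≤1+N with m≤n⇒m<n∨m≡n t≤1+N
  ... | inj₁ t<1+N = inj₁ (s≤s⁻¹ t<1+N , c⁺-≤ (s≤s⁻¹ t<1+N))
  ... | inj₂ refl  = inj₂ (refl , c⁺-last)

  c⁺-injective : (∀ {m l} → m ≤ N → l ≤ N → c m ≡ c l → m ≡ l) → (∀ {t} → t ≤ N → c t ≢ y) →
                 ∀ {m l} → m ≤ suc N → l ≤ suc N → c⁺ m ≡ c⁺ l → m ≡ l
  c⁺-injective c-injective c≢y m≤ l≤ eq with c⁺-view m≤ | c⁺-view l≤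
  ... | inj₁ (m≤N , em) | inj₁ (l≤N , el) = c-injective m≤N l≤N (trans (sym em) (trans eq el))
  ... | inj₁ (m≤N , em) | inj₂ (_ , el)   = ⊥-elim (c≢y m≤N (trans (sym em) (trans eq el)))
  ... | inj₂ (_ , em)   | inj₁ (l≤N , el) = ⊥-elim (c≢y l≤N (trans (sym el) (trans (sym eq) em)))
  ... | inj₂ (refl , _) | inj₂ (refl , _) = refl

  c⁺-chain : ∀ {R : A → A → Set} → (∀ t → t < N → R (c t) (c (suc t))) → R (c N) y →
             ∀ t → t < suc N → R (c⁺ t) (c⁺ (suc t))
  c⁺-chain {R} steps last t t<1+N with m<1+n⇒m<n∨m≡n t<1+N
  ... | inj₁ t<N  = subst₂ R (sym (c⁺-≤ (<⇒≤ t<N))) (sym (c⁺-≤ t<N)) (steps t t<N)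
  ... | inj₂ refl = subst₂ R (sym (c⁺-≤ ≤-refl)) (sym c⁺-last) last

trivial-path : ∀ {n} (G : SGraph n) (μ : Fin n → Fin n) (x : Fin n) → BalancedPath G μ x x 0 (λ _ → x)
trivial-path G μ x = record
  { distinct      = λ { {Fin.zero} {Fin.zero} _ → refl }
  ; edges         = λ ()
  ; start         = refl
  ; end           = refl
  ; nonM-matching = λ ()
  ; covers        = λ _ x≢x → contradiction refl x≢x
  ; uncovered     = λ ()
  }

balanced-path : ∀ {n} (G : SGraph n) (μ : Fin n → Fin n) (c : ℕ → Fin n) (k : ℕ) →
                (∀ {m l} → m ≤ double k → l ≤ double k → c m ≡ c l → m ≡ l) →
                (∀ t → t < double k → adj G (c t) (c (suc t))) →
                (∀ d → double d < double k → μ (c (double d)) ≡ c (suc (double d))) →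
                (∀ t → t < double k → μ (c t) ≢ c (double k)) →
                BalancedPath G μ (c 0) (c (double k)) k (c ∘ toℕ)
balanced-path {n} G μ c k c-injective c-adjacent even-matched end-unmatched = record
  { distinct      = λ {a} {b} eq → toℕ-injective (c-injective (toℕ≤double a) (toℕ≤double b) eq)
  ; edges         = edges
  ; start         = refl
  ; end           = cong c (trans (toℕ-fromℕ (k + k)) (sym (double≡+ k)))
  ; nonM-matching = nonM-matching
  ; covers        = covers
  ; uncovered     = uncovered
  }
  where
  Matched : ℕ → Set
  Matched t = μ (c t) ≡ c (suc t)

  Incident : ℕ → Fin n → Set
  Incident t v = v ≡ c t ⊎ v ≡ c (suc t)

  edge-bound : (i : Fin (k + k)) → toℕ i < double k
  edge-bound i = subst (toℕ i <_) (sym (double≡+ k)) (toℕ<n i)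

  edge-at : ∀ {Q : ℕ → ℕ → Set} t → t < double k → Q t (suc t) →
            Σ (Fin (k + k)) λ i → Q (toℕ (inject₁ i)) (suc (toℕ i))
  edge-at {Q} t t<2k q = i , subst₂ Q (sym (trans (toℕ-inject₁ i) toℕ-i)) (cong suc (sym toℕ-i)) q
    where
    t<k+k = subst (t <_) (double≡+ k) t<2k
    i = fromℕ< t<k+k
    toℕ-i = toℕ-fromℕ< t<k+k

  edges : ∀ i → adj G (c (toℕ (inject₁ i))) (c (suc (toℕ i)))
  edges i rewrite toℕ-inject₁ i = c-adjacent (toℕ i) (edge-bound i)

  unmatched-odd : ∀ t → t < double k → ¬ Matched t → ∃ λ d → t ≡ suc (double d)
  unmatched-odd t t<2k t∉M with even-or-odd t
  ... | inj₁ (d , refl) = ⊥-elim (t∉M (even-matched d t<2k))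
  ... | inj₂ odd        = odd

  endpoint : ∀ {t v} → t < double k → Incident t v →
             ∃ λ q → (q ≡ t ⊎ q ≡ suc t) × q ≤ double k × v ≡ c q
  endpoint {t} t<2k (inj₁ v≡) = t , inj₁ refl , <⇒≤ t<2k , v≡
  endpoint {t} t<2k (inj₂ v≡) = suc t , inj₂ refl , t<2k , v≡

  unmatched-disjoint : ∀ t u v → t < double k → u < double k → t ≢ u →
                       ¬ Matched t → ¬ Matched u → Incident t v → Incident u v → ⊥
  unmatched-disjoint t u v t<2k u<2k t≢u t∉M u∉M v∈t v∈u
    with unmatched-odd t t<2k t∉M | unmatched-odd u u<2k u∉M | endpoint t<2k v∈t | endpoint u<2k v∈u
  ... | _ , refl | _ , refl | q , q∈t , q≤ , v≡ | q′ , q′∈u , q′≤ , v≡′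
    with c-injective q≤ q′≤ (trans (sym v≡) v≡′)
  ... | refl = t≢u (cong (suc ∘ double) (odd-edges-disjoint q∈t q′∈u))

  nonM-matching : ∀ i j v → i ≢ j →
                  μ (c (toℕ (inject₁ i))) ≢ c (suc (toℕ i)) → μ (c (toℕ (inject₁ j))) ≢ c (suc (toℕ j)) →
                  v ≡ c (toℕ (inject₁ i)) ⊎ v ≡ c (suc (toℕ i)) →
                  v ≡ c (toℕ (inject₁ j)) ⊎ v ≡ c (suc (toℕ j)) → ⊥
  nonM-matching i j v i≢j rewrite toℕ-inject₁ i | toℕ-inject₁ j =
    unmatched-disjoint (toℕ i) (toℕ j) v (edge-bound i) (edge-bound j) (i≢j ∘ toℕ-injective)

  covering-edge : ∀ t → t ≤ double k → c t ≢ c (double k) →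
                  ∃ λ u → u < double k × Matched u × Incident u (c t)
  covering-edge t t≤2k t≢end with even-or-odd t
  ... | inj₁ (d , refl) = double d , t<2k , even-matched d t<2k , inj₁ refl
    where t<2k = ≤∧≢⇒< t≤2k (t≢end ∘ cong c)
  ... | inj₂ (d , refl) = double d , t≤2k , even-matched d t≤2k , inj₂ refl

  covers : ∀ a → c (toℕ a) ≢ c (double k) →
           Σ (Fin (k + k)) λ i → μ (c (toℕ (inject₁ i))) ≡ c (suc (toℕ i)) ×
             (c (toℕ a) ≡ c (toℕ (inject₁ i)) ⊎ c (toℕ a) ≡ c (suc (toℕ i)))
  covers a a≢end with covering-edge (toℕ a) (toℕ≤double a) a≢end
  ... | u , u<2k , u∈M , a∈u =
    edge-at {Q = λ s t → μ (c s) ≡ c t × (c (toℕ a) ≡ c s ⊎ c (toℕ a) ≡ c t)} u u<2k (u∈M , a∈u)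

  uncovered : ∀ i → μ (c (toℕ (inject₁ i))) ≡ c (suc (toℕ i)) →
              ¬ (c (double k) ≡ c (toℕ (inject₁ i)) ⊎ c (double k) ≡ c (suc (toℕ i)))
  uncovered i i∈M rewrite toℕ-inject₁ i = λ where
    (inj₁ end≡) → <-irrefl (sym (c-injective ≤-refl (<⇒≤ (edge-bound i)) end≡)) (edge-bound i)
    (inj₂ end≡) → end-unmatched (toℕ i) (edge-bound i) (trans i∈M (sym end≡))

module _ {n} {G : SGraph n} where

  Allowed-sym : ∀ {u v} → Allowed G u v → Allowed G v u
  Allowed-sym {u} (uv , M′ , M′u≡v) =
    SGraph.sym G uv , M′ , trans (cong (proj₁ M′) (sym M′u≡v)) (proj₁ (proj₂ (proj₂ M′ u tt)))

  SameFC-sym : ∀ {u v} → SameFC G u v → SameFC G v u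
  SameFC-sym = reverse Allowed-sym

  component-UH : ∀ {h a w} → UH G h a → CompU G h a w → UH G h w
  component-UH a∈U ε                  = a∈U
  component-UH _   ((_ , b∈U , _) ◅ rest) = component-UH b∈U rest

separating-closed : ∀ {n} (G : SGraph n) {X} → Separating G X → ∀ {z w} → T (X z) → FC G z w → T (X w)
separating-closed G {X} X-separating {z} z∈X z~w with X-separating z
... | inj₁ FCz⊆X = FCz⊆X _ z~w
... | inj₂ FCz∩X≡∅ = contradiction z∈X (FCz∩X≡∅ z ε)

star-within : ∀ {A : Set} {R : A → A → Set} {Q : A → Set} → (∀ {u v} → Q u → R u v → Q v) →
              ∀ {a b} → Q a → Star R a b → Star (λ u v → Q u × Q v × R u v) a b
star-within closed qa ε        = ε
star-within closed qa (r ◅ rs) = (qa , closed qa r , r) ◅ star-within closed (closed qa r) rs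

-- The walk out of U(S)

module ExitWalk {n} (G : SGraph n) (M : PerfectMatching G) {h s x h′ k : Fin n}
  (h⊴h′ : _⊴_ G h h′) (h≉h′ : ¬ SameFC G h h′) (k∈U : UH G h k)
  (Γ-in-S : ∀ v → Nbr G (CompU G h k) v → FC G h v → _∼_ G s v)
  (h′-in-K : ∀ w → FC G h′ w → CompU G h k w)
  (x∈h′ : FC G h′ x) where

  μ : Fin n → Fin n
  μ = proj₁ M

  μ-involutive : ∀ v → μ (μ v) ≡ v
  μ-involutive v = proj₁ (proj₂ (proj₂ M v tt))

  μ-fixed-point-free : ∀ v → μ v ≢ v
  μ-fixed-point-free v = proj₁ (proj₂ (proj₂ (proj₂ M v tt)))

  μ-adjacent : ∀ v → adj G v (μ v)
  μ-adjacent v = proj₂ (proj₂ (proj₂ (proj₂ M v tt)))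

  X : Fin n → Bool
  X = proj₁ h⊴h′

  X-separating : Separating G X
  X-separating = proj₁ (proj₂ h⊴h′)

  H⊆X : ∀ v → FC G h v → T (X v)
  H⊆X = proj₁ (proj₂ (proj₂ h⊴h′))

  H′⊆X : ∀ v → FC G h′ v → T (X v)
  H′⊆X = proj₁ (proj₂ (proj₂ (proj₂ h⊴h′)))

  factor-critical : FactorCriticalOn (ContractGraph G (FC G h)) (ContractVerts G X (FC G h))
  factor-critical = proj₂ (proj₂ (proj₂ (proj₂ h⊴h′)))

  -- the vertices of G[X]/V(H) other than the contracted one
  Outside : Fin n → Set
  Outside v = T (X v) × ¬ FC G h v

  outside-FC : ∀ {z w} → Outside z → FC G z w → Outside w
  outside-FC (z∈X , z∉H) z~w = separating-closed G X-separating z∈X z~w , λ h~w → z∉H (h~w ◅◅ SameFC-sym {G = G} z~w)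

  outside-x : Outside x
  outside-x = outside-FC (H′⊆X h′ ε , h≉h′) x∈h′

  outside-μ : ∀ {v} → Outside v → Outside (μ v)
  outside-μ {v} o = outside-FC o ((μ-adjacent v , M , refl) ◅ ε)

  h⊴outside : ∀ {z} → Outside z → _⊴_ G h z
  h⊴outside (z∈X , _) = X , X-separating , H⊆X , (λ _ → separating-closed G X-separating z∈X) , factor-critical

  outside-UH : ∀ {v} → Outside v → UH G h v
  outside-UH {v} o = (v , h⊴outside o , ε) , proj₂ o

  outside-component : ∀ {z w} → Outside z → FC G z w → CompU G h z w
  outside-component o z~w =
    Star.map (λ (ou , ov , uv) → outside-UH ou , outside-UH ov , proj₁ uv)
             (star-within (λ o uv → outside-FC o (uv ◅ ε)) o z~w)

  μ′ : Maybe (Fin n) → Maybe (Fin n)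
  μ′ = proj₁ (factor-critical (just x) outside-x)

  -- Where μ′ leads to the contracted vertex, β is a junk identity; the walk stops there.
  β : Fin n → Fin n
  β v = fromMaybe v (μ′ (just v))

  data Next (v : Fin n) : Set where
    continue : ∀ {w} → μ′ (just v) ≡ just w → μ′ (just w) ≡ just v →
               Outside w → w ≢ x → w ≢ v → adj G v w → Next v
    exit     : ∀ {y} → FC G h y → adj G v y → Next v

  next : ∀ {v} → Outside v → v ≢ x → Next v
  next {v} o v≢x with μ′ (just v) in μ′v≡ | proj₂ (factor-critical (just x) outside-x) (just v) (o , v≢x ∘ just-injective)
  ... | just w  | (ow , w≢x) , μ′w≡v , w≢v , vw = continue μ′v≡ μ′w≡v ow (w≢x ∘ cong just) (w≢v ∘ cong just) vw
  ... | nothing | _ , _ , _ , (_ , y∈H , vy)      = exit y∈H vy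

  open AlternatingWalk μ β x

  record ValidPrefix (N : ℕ) : Set where
    field
      reversible : Reversible N
      outside    : ∀ i → i ≤ N → Outside (walk i)
      adjacent   : ∀ i → i < N → adj G (walk i) (walk (suc i))

  open ValidPrefix

  prefix-zero : ValidPrefix 0
  prefix-zero = record { reversible = reversible-zero ; outside = λ { zero _ → outside-x } ; adjacent = λ _ () }

  prefix-odd : ∀ j → ValidPrefix (double j) → ValidPrefix (suc (double j))
  prefix-odd j g = record
    { reversible = reversible-suc (reversible g) back (μ-fixed-point-free _ ∘ trans (sym (walk-odd j)))
                     (λ d eq → ⊥-elim (double≢suc-double (suc d) j eq))
    ; outside    = extend-≤ (outside g) (subst Outside (sym (walk-odd j)) (outside-μ (outside g _ ≤-refl)))
    ; adjacent   = extend-< (adjacent g) (subst (adj G _) (sym (walk-odd j)) (μ-adjacent _))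
    }
    where
    back : step (double j) (walk (suc (double j))) ≡ walk (double j)
    back = begin
      step (double j) (walk (suc (double j)))  ≡⟨ cong (λ f → f (walk (suc (double j)))) (step-+-double 0 j) ⟩
      μ (walk (suc (double j)))                ≡⟨ cong μ (walk-odd j) ⟩
      μ (μ (walk (double j)))                  ≡⟨ μ-involutive _ ⟩
      walk (double j)                          ∎

  prefix-even : ∀ j {w} → ValidPrefix (suc (double j)) →
              μ′ (just (walk (suc (double j)))) ≡ just w → μ′ (just w) ≡ just (walk (suc (double j))) →
              Outside w → w ≢ x → w ≢ walk (suc (double j)) → adj G (walk (suc (double j))) w →
              ValidPrefix (double (suc j))
  prefix-even j {w} g μ′v≡w μ′w≡v ow w≢x w≢v vw = record
    { reversible = reversible-suc (reversible g) back (w≢v ∘ trans (sym walk≡w))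
                     (λ _ _ → w≢x ∘ trans (sym walk≡w))
    ; outside    = extend-≤ (outside g) (subst Outside (sym walk≡w) ow)
    ; adjacent   = extend-< (adjacent g) (subst (adj G _) (sym walk≡w) vw)
    }
    where
    walk≡w : walk (double (suc j)) ≡ w
    walk≡w = trans (walk-even j) (cong (fromMaybe _) μ′v≡w)
    back : step (suc (double j)) (walk (double (suc j))) ≡ walk (suc (double j))
    back = begin
      step (suc (double j)) (walk (double (suc j)))  ≡⟨ cong (λ f → f (walk (double (suc j)))) (step-+-double 1 j) ⟩
      β (walk (double (suc j)))                      ≡⟨ cong β walk≡w ⟩
      β w                                            ≡⟨ cong (fromMaybe w) μ′w≡v ⟩
      walk (suc (double j))                          ∎

  prefix-short : ∀ {N} → ValidPrefix N → N < n
  prefix-short {N} g = ≰⇒> λ n≤N →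
    let i , j , i<j , eq = pigeonhole (s≤s n≤N) (walk ∘ toℕ)
    in <-irrefl (walk-injective (reversible g) (s≤s⁻¹ (toℕ<n i)) (s≤s⁻¹ (toℕ<n j)) eq) i<j

  record Exit : Set where
    field
      j        : ℕ
      prefix   : ValidPrefix (suc (double j))
      y        : Fin n
      y∈H      : FC G h y
      last-adj : adj G (walk (suc (double j))) y

  exit-exists : Exit
  exit-exists = search n 0 ≤-refl prefix-zero
    where
    j≤double : ∀ j → j ≤ double j
    j≤double j = subst (j ≤_) (sym (double≡+ j)) (m≤m+n j j)

    -- The walk has 2j+1 distinct vertices, so fuel bounds the number of remaining rounds.
    search : ∀ fuel j → n ≤ j + fuel → ValidPrefix (double j) → Exit
    search zero j n≤j g =
      ⊥-elim (<⇒≱ (prefix-short g) (≤-trans (subst (n ≤_) (+-identityʳ j) n≤j) (j≤double j)))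
    search (suc fuel) j n≤ g with prefix-odd j g
    ... | g′ with next (outside g′ _ ≤-refl) (0≢1+n ∘ walk-injective (reversible g′) z≤n ≤-refl ∘ sym)
    ...   | exit y∈H vy = record { j = j ; prefix = g′ ; y = _ ; y∈H = y∈H ; last-adj = vy }
    ...   | continue μ′v≡w μ′w≡v ow w≢x w≢v vw =
      search fuel (suc j) (subst (n ≤_) (+-suc j fuel) n≤) (prefix-even j g′ μ′v≡w μ′w≡v ow w≢x w≢v vw)

  open Exit exit-exists public using (j; y)
  open Exit exit-exists using (prefix; y∈H; last-adj)

  N : ℕ
  N = suc (double j)

  open Extend walk N y

  walk≢y : ∀ {t} → t ≤ N → walk t ≢ y
  walk≢y t≤N eq = proj₂ (outside prefix _ t≤N) (subst (FC G h) (sym eq) y∈H)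

  μ-walk≢y : ∀ {t} → t ≤ N → μ (walk t) ≢ y
  μ-walk≢y t≤N eq = proj₂ (outside-μ (outside prefix _ t≤N)) (subst (FC G h) (sym eq) y∈H)

  path : Fin (suc (suc j + suc j)) → Fin n
  path = c⁺ ∘ toℕ

  path-balanced : BalancedPath G μ x y (suc j) path
  path-balanced = subst₂ (λ a b → BalancedPath G μ a b (suc j) path) (c⁺-≤ z≤n) c⁺-last
    (balanced-path G μ c⁺ (suc j) (c⁺-injective (walk-injective (reversible prefix)) walk≢y)
      (c⁺-chain {R = adj G} (adjacent prefix) last-adj) even-matched end-unmatched)
    where
    even-matched : ∀ d → double d < suc N → μ (c⁺ (double d)) ≡ c⁺ (suc (double d))
    even-matched d 2d<1+N = begin
      μ (c⁺ (double d))     ≡⟨ cong μ (c⁺-≤ (<⇒≤ 2d<N)) ⟩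
      μ (walk (double d))   ≡⟨ walk-odd d ⟨
      walk (suc (double d)) ≡⟨ c⁺-≤ 2d<N ⟨
      c⁺ (suc (double d))   ∎
      where 2d<N = ≤∧≢⇒< (s≤s⁻¹ 2d<1+N) (double≢suc-double d j)
    end-unmatched : ∀ t → t < suc N → μ (c⁺ t) ≢ c⁺ (suc N)
    end-unmatched t t<1+N eq =
      μ-walk≢y (s≤s⁻¹ t<1+N) (trans (cong μ (sym (c⁺-≤ (s≤s⁻¹ t<1+N)))) (trans eq c⁺-last))

  walk-in-K : ∀ t → t ≤ N → CompU G h k (walk t)
  walk-in-K zero    _    = h′-in-K x x∈h′
  walk-in-K (suc t) t<N  = walk-in-K t (<⇒≤ t<N) ◅◅
    Star.return (outside-UH (outside prefix t (<⇒≤ t<N)) , outside-UH (outside prefix (suc t) t<N) , adjacent prefix t t<N)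

  walk-in-US : ∀ t → t ≤ N → US G h s (walk t)
  walk-in-US t t≤N = walk t , k , h⊴outside o , proj₂ o , k∈U , Γ-in-S ,
                     (λ _ z~w → walk-in-K t t≤N ◅◅ outside-component o z~w) , ε
    where o = outside prefix t t≤N

  path-in-US : ∀ a → path a ≢ y → US G h s (path a)
  path-in-US a a≢y with c⁺-view (toℕ≤double {suc j} a)
  ... | inj₁ (t≤N , eq) = subst (US G h s) (sym eq) (walk-in-US _ t≤N)
  ... | inj₂ (_ , eq)   = contradiction eq a≢y

  s∼y : _∼_ G s y
  s∼y = Γ-in-S y ((λ k~y → proj₂ (component-UH k∈U k~y) y∈H) , walk N , walk-in-K N ≤-refl , last-adj) y∈H

lemma3 : ∀ {n} (G : SGraph n) → Factorizable G → (M : PerfectMatching G) →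
           (h s : Fin n) → FC G h s → (x : Fin n) → UStarS G h s x →
           Σ (Fin n) λ y → _∼_ G s y × Σ ℕ λ k →
             Σ (Fin (suc (k + k)) → Fin n) λ p →
               BalancedPath G (proj₁ M) x y k p × (∀ a → p a ≢ y → US G h s (p a))
lemma3 G _ M h s _ x (inj₂ s∼x) =
  x , s∼x , 0 , (λ _ → x) , trivial-path G (proj₁ M) x , λ _ x≢x → contradiction refl x≢x
lemma3 G _ M h s _ x (inj₁ (h′ , k , h⊴h′ , h≉h′ , k∈U , Γ-in-S , h′-in-K , x∈h′)) =
  y , s∼y , suc j , path , path-balanced , path-in-US
  where open ExitWalk G M h⊴h′ h≉h′ k∈U Γ-in-S h′-in-K x∈h′
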